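{- For every $n\ge1$, there is a bijection between the set of noncrossing, nonnesting set partitions of $[n]$ and $\mathcal{S}_n(321,3412)$.
   Context: A set partition of $[n]$ is represented by its arc diagram: an arc $(i,j)$ with $i<j$ joins each pair of elements that are consecutive (in increasing order) within the same block. Two arcs $(i_1,j_1),(i_2,j_2)$ form a crossing if $i_1<i_2<j_1<j_2$ and a nesting if $i_1<i_2<j_2<j_1$; a partition is noncrossing (nonnesting) if it has no crossing (nesting). $\mathcal{S}_n(321,3412)$ is the set of permutations of $[n]$ (one-line notation) having no subsequence in the same relative order as $321$ or as $3412$. -}

module Defs where

open import Data.Bool using (Bool; true; false; _∧_; _∨_; not; T)
open import Data.Nat using (ℕ; zero; suc)
open import Data.Fin using (Fin; zero; suc; _<?_; _≟_)
open import Data.Vec using (Vec; lookup)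
open import Data.Product using (Σ)
open import Relation.Nullary.Decidable using (⌊_⌋)

-- Boolean quantifiers over Fin n (decidable, so the resulting
-- predicates T (...) are proof-irrelevant and ≡ on the subtypes is the
-- intended equality of objects).
allF : ∀ {n} → (Fin n → Bool) → Bool
allF {zero}  p = true
allF {suc n} p = p zero ∧ allF (λ i → p (suc i))

anyF : ∀ {n} → (Fin n → Bool) → Bool
anyF {zero}  p = false
anyF {suc n} p = p zero ∨ anyF (λ i → p (suc i))

_⇒ᵇ_ : Bool → Bool → Bool
a ⇒ᵇ b = not a ∨ b

_<ᵇ_ : ∀ {n} → Fin n → Fin n → Bool
i <ᵇ j = ⌊ i <? j ⌋

_≡ᵇ_ : ∀ {n} → Fin n → Fin n → Bool
i ≡ᵇ j = ⌊ i ≟ j ⌋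

-- Set partitions of [n] = {0,…,n-1} (0-indexed), given as equivalence
-- relations on Fin n (the blocks are the equivalence classes), stored
-- as a Boolean n×n matrix.

BRel : ℕ → Set
BRel n = Vec (Vec Bool n) n

rel : ∀ {n} → BRel n → Fin n → Fin n → Bool
rel r i j = lookup (lookup r i) j

isEquivᵇ : ∀ {n} → BRel n → Bool
isEquivᵇ r =
  allF (λ i → rel r i i) ∧
  allF (λ i → allF (λ j → rel r i j ⇒ᵇ rel r j i)) ∧
  allF (λ i → allF (λ j → allF (λ k → (rel r i j ∧ rel r j k) ⇒ᵇ rel r i k)))

SetPartition : ℕ → Set
SetPartition n = Σ (BRel n) (λ r → T (isEquivᵇ r))

arc : ∀ {n} → BRel n → Fin n → Fin n → Bool
arc r i j = (i <ᵇ j) ∧ rel r i j ∧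
  not (anyF (λ k → (i <ᵇ k) ∧ (k <ᵇ j) ∧ rel r i k))

hasCrossing : ∀ {n} → BRel n → Bool
hasCrossing r =
  anyF λ i₁ → anyF λ j₁ → anyF λ i₂ → anyF λ j₂ →
    arc r i₁ j₁ ∧ arc r i₂ j₂ ∧ (i₁ <ᵇ i₂) ∧ (i₂ <ᵇ j₁) ∧ (j₁ <ᵇ j₂)

hasNesting : ∀ {n} → BRel n → Bool
hasNesting r =
  anyF λ i₁ → anyF λ j₁ → anyF λ i₂ → anyF λ j₂ →
    arc r i₁ j₁ ∧ arc r i₂ j₂ ∧ (i₁ <ᵇ i₂) ∧ (i₂ <ᵇ j₂) ∧ (j₂ <ᵇ j₁)

NCNNPartition : ℕ → Set
NCNNPartition n =
  Σ (BRel n) (λ r → T (isEquivᵇ r ∧ not (hasCrossing r) ∧ not (hasNesting r)))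

-- Permutations of [n] in one-line notation: a vector w with w(i) = lookup w i,
-- required to be injective (hence bijective on Fin n).

isPermᵇ : ∀ {n} → Vec (Fin n) n → Bool
isPermᵇ w = allF λ i → allF λ j → (lookup w i ≡ᵇ lookup w j) ⇒ᵇ (i ≡ᵇ j)

contains321 : ∀ {n} → Vec (Fin n) n → Bool
contains321 w =
  anyF λ i → anyF λ j → anyF λ k →
    (i <ᵇ j) ∧ (j <ᵇ k) ∧
    (lookup w j <ᵇ lookup w i) ∧ (lookup w k <ᵇ lookup w j)

contains3412 : ∀ {n} → Vec (Fin n) n → Bool
contains3412 w =
  anyF λ i → anyF λ j → anyF λ k → anyF λ l →
    (i <ᵇ j) ∧ (j <ᵇ k) ∧ (k <ᵇ l) ∧
    (lookup w k <ᵇ lookup w l) ∧ (lookup w l <ᵇ lookup w i) ∧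
    (lookup w i <ᵇ lookup w j)

Av321-3412 : ℕ → Set
Av321-3412 n =
  Σ (Vec (Fin n) n)
    (λ w → T (isPermᵇ w ∧ not (contains321 w) ∧ not (contains3412 w)))

-- Both classes obey one recursion. Let X(n) be the objects on [n] and Y(n) those on [n+1]
-- in which 0 is not a singleton block (for partitions) or not a fixed point (for
-- permutations); then X(n+1) ≅ X(n) ⊎ Y(n), Y(n+1) ≅ X(n+1) ⊎ Y(n) and Y(0) = ∅.
-- Partitions: if 0 is a singleton, delete it; otherwise, if 0 ~ 1, merge 0 into the block
-- of 1, and if not, noncrossing and nonnesting force 1 to be a singleton, which is deleted.
-- Permutations w: if w(0) = 0, delete this fixed point; otherwise, if w(1) = 0, delete the
-- point (1, 0), and if not, avoiding 321 and 3412 forces w(0) = 1 and the point (0, 1) is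
-- deleted. The deleted point never lies on a crossing, a nesting or a pattern occurrence,
-- so each deletion is a bijection onto the smaller class.

module Submission where

open import Defs
open import Data.Bool using (Bool; true; false; _∧_; _∨_; not; T)
open import Data.Bool.Properties using (T-irrelevant; ¬-not; ⇔→≡)
open import Data.Empty using (⊥; ⊥-elim)
open import Data.Fin using (Fin; zero; suc; toℕ; _<_; _<?_; _≟_; punchIn; punchOut; pinch)
open import Data.Fin.Properties
  using (<⇒≢; punchIn-punchOut; punchOut-punchIn; punchInᵢ≢i; punchIn-injective; punchOut-cong;
         punchOut-injective; <-cmp; pigeonhole; any?; 0≢1+n)
open import Data.Nat as ℕ using (ℕ; z≤n; s≤s; _≥_)
open import Data.Nat.Properties using (<-irrefl; <-trans; <-≤-trans; n≮0; n<1+n)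
open import Data.Product using (Σ; ∃; _×_; _,_; proj₁; proj₂)
open import Data.Sum as Sum using (_⊎_; inj₁; inj₂; [_,_])
open import Data.Sum.Function.Propositional using (_⊎-↔_)
open import Data.Unit using (tt)
open import Data.Vec using (Vec; []; _∷_; lookup; tabulate)
open import Data.Vec.Properties using (lookup∘tabulate; tabulate∘lookup; tabulate-cong)
open import Function using (_∘_; _on_; Injective; mk⇔; _↔_; _⤖_; mk↔ₛ′)
open import Function.Properties.Inverse using (↔-refl; ↔-sym; ↔-trans; ↔⇒⤖)
open import Relation.Binary using (IsEquivalence; tri<; tri≈; tri>)
import Relation.Binary.Construct.On as On
open import Relation.Binary.PropositionalEquality hiding ([_])
open import Relation.Nullary using (yes; no; contradiction)
open import Relation.Nullary.Decidable using (toWitness; fromWitness)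

≡true⇒T : ∀ {b} → b ≡ true → T b
≡true⇒T refl = tt

T⇒≡true : ∀ {b} → T b → b ≡ true
T⇒≡true {true} _ = refl

≡true⇒≢false : ∀ {b} → b ≡ true → b ≢ false
≡true⇒≢false refl ()

∧-trueˡ : ∀ {a b} → a ∧ b ≡ true → a ≡ true
∧-trueˡ {true} _ = refl

∧-trueʳ : ∀ {a b} → a ∧ b ≡ true → b ≡ true
∧-trueʳ {true} ab = ab

∧-true : ∀ {a b} → a ≡ true → b ≡ true → a ∧ b ≡ true
∧-true refl refl = refl

not-true⁻ : ∀ {b} → not b ≡ true → b ≡ false
not-true⁻ {false} _ = refl

not-true : ∀ {b} → b ≡ false → not b ≡ true
not-true refl = refl

not-false⁻ : ∀ {b} → not b ≡ false → b ≡ true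
not-false⁻ {true} _ = refl

⇒ᵇ-true⁻ : ∀ {a b} → (a ⇒ᵇ b) ≡ true → a ≡ true → b ≡ true
⇒ᵇ-true⁻ a⇒b refl = a⇒b

⇒ᵇ-true : ∀ {a b} → (a ≡ true → b ≡ true) → (a ⇒ᵇ b) ≡ true
⇒ᵇ-true {true}  a→b = a→b refl
⇒ᵇ-true {false} _   = refl

<ᵇ⇒< : ∀ {n} {i j : Fin n} → (i <ᵇ j) ≡ true → i < j
<ᵇ⇒< {i = i} {j} = toWitness {a? = i <? j} ∘ ≡true⇒T

<⇒<ᵇ : ∀ {n} {i j : Fin n} → i < j → (i <ᵇ j) ≡ true
<⇒<ᵇ {i = i} {j} = T⇒≡true ∘ fromWitness {a? = i <? j}

≡ᵇ⇒≡ : ∀ {n} {i j : Fin n} → (i ≡ᵇ j) ≡ true → i ≡ j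
≡ᵇ⇒≡ {i = i} {j} = toWitness {a? = i ≟ j} ∘ ≡true⇒T

≡⇒≡ᵇ : ∀ {n} {i j : Fin n} → i ≡ j → (i ≡ᵇ j) ≡ true
≡⇒≡ᵇ {i = i} {j} = T⇒≡true ∘ fromWitness {a? = i ≟ j}

<ᵇ-∧⁻ : ∀ {n} {i j : Fin n} {b} → (i <ᵇ j) ∧ b ≡ true → i < j × b ≡ true
<ᵇ-∧⁻ {i = i} {j} t = <ᵇ⇒< (∧-trueˡ {i <ᵇ j} t) , ∧-trueʳ {i <ᵇ j} t

<ᵇ-∧⁺ : ∀ {n} {i j : Fin n} {b} → i < j → b ≡ true → (i <ᵇ j) ∧ b ≡ true
<ᵇ-∧⁺ i<j b = ∧-true (<⇒<ᵇ i<j) b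

suc-<ᵇ : ∀ {n} (i j : Fin n) → (suc i <ᵇ suc j) ≡ (i <ᵇ j)
suc-<ᵇ i j = ⇔→≡ (mk⇔ (<⇒<ᵇ ∘ ℕ.s<s⁻¹ ∘ <ᵇ⇒<) (<⇒<ᵇ ∘ ℕ.s<s ∘ <ᵇ⇒<))

punchIn-<ᵇ : ∀ {n} (p : Fin (ℕ.suc n)) (i j : Fin n) → (punchIn p i <ᵇ punchIn p j) ≡ (i <ᵇ j)
punchIn-<ᵇ zero    i       j       = suc-<ᵇ i j
punchIn-<ᵇ (suc p) zero    zero    = refl
punchIn-<ᵇ (suc p) zero    (suc j) = refl
punchIn-<ᵇ (suc p) (suc i) zero    = refl
punchIn-<ᵇ (suc p) (suc i) (suc j) =
  trans (suc-<ᵇ (punchIn p i) (punchIn p j)) (trans (punchIn-<ᵇ p i j) (sym (suc-<ᵇ i j)))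

punchIn-preimage : ∀ {n} {p x : Fin (ℕ.suc n)} → x ≢ p → ∃ λ i → punchIn p i ≡ x
punchIn-preimage x≢p = punchOut (x≢p ∘ sym) , punchIn-punchOut (x≢p ∘ sym)

anyF⁺ : ∀ {n} (q : Fin n → Bool) i → q i ≡ true → anyF q ≡ true
anyF⁺ q zero    qi = cong (_∨ anyF (q ∘ suc)) qi
anyF⁺ q (suc i) qi with q zero
... | true  = refl
... | false = anyF⁺ (q ∘ suc) i qi

anyF⁻ : ∀ {n} (q : Fin n → Bool) → anyF q ≡ true → ∃ λ i → q i ≡ true
anyF⁻ {ℕ.suc n} q t with q zero in q0
... | true  = zero , q0
... | false with i , qi ← anyF⁻ (q ∘ suc) t = suc i , qi

anyF-least : ∀ {n} (q : Fin n → Bool) → anyF q ≡ true →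
             ∃ λ i → q i ≡ true × (∀ j → j < i → q j ≡ false)
anyF-least {ℕ.suc n} q t with q zero in q0
... | true  = zero , q0 , λ _ ()
... | false with i , qi , least ← anyF-least (q ∘ suc) t = suc i , qi , below
  where
  below : ∀ j → j < suc i → q j ≡ false
  below zero    _         = q0
  below (suc j) (ℕ.s<s j<i) = least j j<i

anyF-cong : ∀ {n} {q q′ : Fin n → Bool} → (∀ i → q i ≡ q′ i) → anyF q ≡ anyF q′
anyF-cong {ℕ.zero}  _  = refl
anyF-cong {ℕ.suc n} eq = cong₂ _∨_ (eq zero) (anyF-cong (eq ∘ suc))

allF⁺ : ∀ {n} (q : Fin n → Bool) → (∀ i → q i ≡ true) → allF q ≡ true
allF⁺ {ℕ.zero}  q _  = refl
allF⁺ {ℕ.suc n} q qs = ∧-true (qs zero) (allF⁺ (q ∘ suc) (qs ∘ suc))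

allF⁻ : ∀ {n} (q : Fin n → Bool) → allF q ≡ true → ∀ i → q i ≡ true
allF⁻ q t zero    = ∧-trueˡ t
allF⁻ q t (suc i) = allF⁻ (q ∘ suc) (∧-trueʳ {q zero} t) i

allF-false⁻ : ∀ {n} (q : Fin n → Bool) → allF q ≡ false → ∃ λ i → q i ≡ false
allF-false⁻ {ℕ.suc n} q f with q zero in q0
... | false = zero , q0
... | true with i , qi ← allF-false⁻ (q ∘ suc) f = suc i , qi

anyF-punchIn : ∀ {n} (p : Fin (ℕ.suc n)) (q : Fin (ℕ.suc n) → Bool) → q p ≡ false →
               anyF q ≡ anyF (q ∘ punchIn p)
anyF-punchIn p q qp = ⇔→≡ (mk⇔ to (λ t → let i , qi = anyF⁻ _ t in anyF⁺ q (punchIn p i) qi))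
  where
  to : anyF q ≡ true → anyF (q ∘ punchIn p) ≡ true
  to t with x , qx ← anyF⁻ q t with x ≟ p
  ... | yes refl = ⊥-elim (≡true⇒≢false qx qp)
  ... | no x≢p with i , refl ← punchIn-preimage x≢p = anyF⁺ _ i qx

Triple : ℕ → Set
Triple n = Fin n → Fin n → Fin n → Bool

any3 : ∀ {n} → Triple n → Bool
any3 B = anyF λ a → anyF λ b → anyF λ c → B a b c

any3⁺ : ∀ {n} (B : Triple n) a b c → B a b c ≡ true → any3 B ≡ true
any3⁺ B a b c t = anyF⁺ _ a (anyF⁺ _ b (anyF⁺ (B a b) c t))

any3⁻ : ∀ {n} (B : Triple n) → any3 B ≡ true → ∃ λ a → ∃ λ b → ∃ λ c → B a b c ≡ true
any3⁻ B t with a , t ← anyF⁻ _ t with b , t ← anyF⁻ _ t with c , t ← anyF⁻ _ t = a , b , c , t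

any3-punchIn : ∀ {n} (p : Fin (ℕ.suc n)) (B : Triple (ℕ.suc n)) (B′ : Triple n) →
  (∀ a b c → B (punchIn p a) (punchIn p b) (punchIn p c) ≡ B′ a b c) →
  (∀ a b c → B a b c ≡ true → a ≢ p × b ≢ p × c ≢ p) →
  any3 B ≡ any3 B′
any3-punchIn p B B′ B≡B′ avoid = ⇔→≡ (mk⇔ to from)
  where
  to : any3 B ≡ true → any3 B′ ≡ true
  to t with a , b , c , occ ← any3⁻ B t with a≢p , b≢p , c≢p ← avoid a b c occ
     with a′ , refl ← punchIn-preimage a≢p | b′ , refl ← punchIn-preimage b≢p
        | c′ , refl ← punchIn-preimage c≢p
     = any3⁺ B′ a′ b′ c′ (trans (sym (B≡B′ a′ b′ c′)) occ)
  from : any3 B′ ≡ true → any3 B ≡ true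
  from t with a , b , c , occ ← any3⁻ B′ t = any3⁺ B _ _ _ (trans (B≡B′ a b c) occ)

Quad : ℕ → Set
Quad n = Fin n → Fin n → Fin n → Fin n → Bool

any4 : ∀ {n} → Quad n → Bool
any4 B = anyF λ a → anyF λ b → anyF λ c → anyF λ d → B a b c d

any4⁺ : ∀ {n} (B : Quad n) a b c d → B a b c d ≡ true → any4 B ≡ true
any4⁺ B a b c d t = anyF⁺ _ a (anyF⁺ _ b (anyF⁺ _ c (anyF⁺ (B a b c) d t)))

any4⁻ : ∀ {n} (B : Quad n) → any4 B ≡ true → ∃ λ a → ∃ λ b → ∃ λ c → ∃ λ d → B a b c d ≡ true
any4⁻ B t with a , t ← anyF⁻ _ t with b , t ← anyF⁻ _ t with c , t ← anyF⁻ _ t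
                with d , t ← anyF⁻ _ t = a , b , c , d , t

any4-punchIn : ∀ {n} (p : Fin (ℕ.suc n)) (B : Quad (ℕ.suc n)) (B′ : Quad n) →
  (∀ a b c d → B (punchIn p a) (punchIn p b) (punchIn p c) (punchIn p d) ≡ B′ a b c d) →
  (∀ a b c d → B a b c d ≡ true → a ≢ p × b ≢ p × c ≢ p × d ≢ p) →
  any4 B ≡ any4 B′
any4-punchIn p B B′ B≡B′ avoid = ⇔→≡ (mk⇔ to from)
  where
  to : any4 B ≡ true → any4 B′ ≡ true
  to t with a , b , c , d , occ ← any4⁻ B t with a≢p , b≢p , c≢p , d≢p ← avoid a b c d occ
     with a′ , refl ← punchIn-preimage a≢p | b′ , refl ← punchIn-preimage b≢p
        | c′ , refl ← punchIn-preimage c≢p | d′ , refl ← punchIn-preimage d≢p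
     = any4⁺ B′ a′ b′ c′ d′ (trans (sym (B≡B′ a′ b′ c′ d′)) occ)
  from : any4 B′ ≡ true → any4 B ≡ true
  from t with a , b , c , d , occ ← any4⁻ B′ t =
    any4⁺ B _ _ _ _ (trans (B≡B′ a b c d) occ)

subtype-≡ : ∀ {A : Set} {P : A → Bool} {x y : Σ A (T ∘ P)} → proj₁ x ≡ proj₁ y → x ≡ y
subtype-≡ {x = a , t} {.a , t′} refl = cong (a ,_) (T-irrelevant t t′)

decide : (b : Bool) → T b ⊎ T (not b)
decide true  = inj₁ tt
decide false = inj₂ tt

decide-true : ∀ b (t : T b) → decide b ≡ inj₁ t
decide-true true tt = refl

decide-false : ∀ b (t : T (not b)) → decide b ≡ inj₂ t
decide-false false tt = refl

split↔ : ∀ {A : Set} (P : A → Bool) → A ↔ (Σ A (T ∘ P) ⊎ Σ A (T ∘ not ∘ P))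
split↔ {A} P = mk↔ₛ′ to from to∘from from∘to
  where
  to : A → Σ A (T ∘ P) ⊎ Σ A (T ∘ not ∘ P)
  to a = Sum.map (a ,_) (a ,_) (decide (P a))
  from : Σ A (T ∘ P) ⊎ Σ A (T ∘ not ∘ P) → A
  from = [ proj₁ , proj₁ ]
  to∘from : ∀ x → to (from x) ≡ x
  to∘from (inj₁ (a , t)) = cong (Sum.map (a ,_) (a ,_)) (decide-true (P a) t)
  to∘from (inj₂ (a , t)) = cong (Sum.map (a ,_) (a ,_)) (decide-false (P a) t)
  from∘to : ∀ a → from (to a) ≡ a
  from∘to a with decide (P a)
  ... | inj₁ _ = refl
  ... | inj₂ _ = refl

-- Noncrossing nonnesting partitions

BoolRel : ℕ → Set
BoolRel n = Fin n → Fin n → Bool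

Holds : ∀ {n} → BoolRel n → Fin n → Fin n → Set
Holds f i j = f i j ≡ true

isEquivᵇ⁻ : ∀ {n} (r : BRel n) → isEquivᵇ r ≡ true → IsEquivalence (Holds (rel r))
isEquivᵇ⁻ r t = record
  { refl  = λ {i} → allF⁻ _ (∧-trueˡ t) i
  ; sym   = λ {i} {j} → ⇒ᵇ-true⁻ (allF⁻ _ (allF⁻ _ (∧-trueˡ t′) i) j)
  ; trans = λ {i} {j} {k} rij rjk →
      ⇒ᵇ-true⁻ (allF⁻ _ (allF⁻ _ (allF⁻ _ t″ i) j) k) (∧-true rij rjk)
  }
  where
  t′ = ∧-trueʳ {allF λ i → rel r i i} t
  t″ = ∧-trueʳ {allF λ i → allF λ j → rel r i j ⇒ᵇ rel r j i} t′

isEquivᵇ⁺ : ∀ {n} (r : BRel n) → IsEquivalence (Holds (rel r)) → isEquivᵇ r ≡ true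
isEquivᵇ⁺ r E =
  ∧-true (allF⁺ (λ i → f i i) λ _ → E.refl)
  (∧-true (allF⁺ (λ i → allF λ j → f i j ⇒ᵇ f j i) λ i →
             allF⁺ (λ j → f i j ⇒ᵇ f j i) λ _ → ⇒ᵇ-true E.sym)
          (allF⁺ (λ i → allF λ j → allF λ k → (f i j ∧ f j k) ⇒ᵇ f i k) λ i →
             allF⁺ (λ j → allF λ k → (f i j ∧ f j k) ⇒ᵇ f i k) λ j →
             allF⁺ (λ k → (f i j ∧ f j k) ⇒ᵇ f i k) λ _ →
             ⇒ᵇ-true λ t → E.trans (∧-trueˡ t) (∧-trueʳ {f i j} t)))
  where
  module E = IsEquivalence E
  f = rel r

record IsArc {n} (f : BoolRel n) (i j : Fin n) : Set where
  field
    ordered     : i < j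
    related     : f i j ≡ true
    consecutive : ∀ k → i < k → k < j → f i k ≡ false
open IsArc

arc⁻ : ∀ {n} (r : BRel n) {i j} → arc r i j ≡ true → IsArc (rel r) i j
arc⁻ r {i} {j} t with i<j , t′ ← <ᵇ-∧⁻ t = record
  { ordered     = i<j
  ; related     = ∧-trueˡ t′
  ; consecutive = λ k i<k k<j → ¬-not λ rik →
      ≡true⇒≢false (anyF⁺ _ k (<ᵇ-∧⁺ i<k (<ᵇ-∧⁺ k<j rik))) (not-true⁻ (∧-trueʳ {rel r i j} t′))
  }

arc⁺ : ∀ {n} (r : BRel n) {i j} → IsArc (rel r) i j → arc r i j ≡ true
arc⁺ r {i} {j} a = <ᵇ-∧⁺ (ordered a) (∧-true (related a) (not-true (¬-not inside)))
  where
  inside : anyF (λ k → (i <ᵇ k) ∧ (k <ᵇ j) ∧ rel r i k) ≢ true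
  inside t with k , t ← anyF⁻ _ t with i<k , t ← <ᵇ-∧⁻ t with k<j , rik ← <ᵇ-∧⁻ t =
    ≡true⇒≢false rik (consecutive a k i<k k<j)

arc-from : ∀ {n} (r : BRel n) {i j} → i < j → rel r i j ≡ true → ∃ λ s → IsArc (rel r) i s
arc-from r {i} {j} i<j rij
  with s , t , least ← anyF-least (λ k → (i <ᵇ k) ∧ rel r i k) (anyF⁺ _ j (<ᵇ-∧⁺ i<j rij))
  with i<s , ris ← <ᵇ-∧⁻ t = s , record
  { ordered     = i<s
  ; related     = ris
  ; consecutive = λ k i<k k<s → ¬-not λ rik → ≡true⇒≢false (<ᵇ-∧⁺ i<k rik) (least k k<s)
  }

crossingᵇ : ∀ {n} → BRel n → Quad n
crossingᵇ r i₁ j₁ i₂ j₂ = arc r i₁ j₁ ∧ arc r i₂ j₂ ∧ (i₁ <ᵇ i₂) ∧ (i₂ <ᵇ j₁) ∧ (j₁ <ᵇ j₂)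

nestingᵇ : ∀ {n} → BRel n → Quad n
nestingᵇ r i₁ j₁ i₂ j₂ = arc r i₁ j₁ ∧ arc r i₂ j₂ ∧ (i₁ <ᵇ i₂) ∧ (i₂ <ᵇ j₂) ∧ (j₂ <ᵇ j₁)

Crossing : ∀ {n} → BRel n → Fin n → Fin n → Fin n → Fin n → Set
Crossing r i₁ j₁ i₂ j₂ = IsArc (rel r) i₁ j₁ × IsArc (rel r) i₂ j₂ × i₁ < i₂ × i₂ < j₁ × j₁ < j₂

Nesting : ∀ {n} → BRel n → Fin n → Fin n → Fin n → Fin n → Set
Nesting r i₁ j₁ i₂ j₂ = IsArc (rel r) i₁ j₁ × IsArc (rel r) i₂ j₂ × i₁ < i₂ × i₂ < j₂ × j₂ < j₁

crossingᵇ⁻ : ∀ {n} (r : BRel n) {a b c d} → crossingᵇ r a b c d ≡ true → Crossing r a b c d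
crossingᵇ⁻ r {a} {b} {c} {d} t
  with t₂ ← ∧-trueʳ {arc r a b} t with t₃ ← ∧-trueʳ {arc r c d} t₂
  with a<c , t₄ ← <ᵇ-∧⁻ t₃ with c<b , b<d ← <ᵇ-∧⁻ t₄ =
  arc⁻ r (∧-trueˡ t) , arc⁻ r (∧-trueˡ t₂) , a<c , c<b , <ᵇ⇒< b<d

crossingᵇ⁺ : ∀ {n} (r : BRel n) {a b c d} → Crossing r a b c d → crossingᵇ r a b c d ≡ true
crossingᵇ⁺ r (ab , cd , a<c , c<b , b<d) =
  ∧-true (arc⁺ r ab) (∧-true (arc⁺ r cd) (<ᵇ-∧⁺ a<c (<ᵇ-∧⁺ c<b (<⇒<ᵇ b<d))))

nestingᵇ⁻ : ∀ {n} (r : BRel n) {a b c d} → nestingᵇ r a b c d ≡ true → Nesting r a b c d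
nestingᵇ⁻ r {a} {b} {c} {d} t
  with t₂ ← ∧-trueʳ {arc r a b} t with t₃ ← ∧-trueʳ {arc r c d} t₂
  with a<c , t₄ ← <ᵇ-∧⁻ t₃ with c<d , d<b ← <ᵇ-∧⁻ t₄ =
  arc⁻ r (∧-trueˡ t) , arc⁻ r (∧-trueˡ t₂) , a<c , c<d , <ᵇ⇒< d<b

nestingᵇ⁺ : ∀ {n} (r : BRel n) {a b c d} → Nesting r a b c d → nestingᵇ r a b c d ≡ true
nestingᵇ⁺ r (ab , cd , a<c , c<d , d<b) =
  ∧-true (arc⁺ r ab) (∧-true (arc⁺ r cd) (<ᵇ-∧⁺ a<c (<ᵇ-∧⁺ c<d (<⇒<ᵇ d<b))))

ncnnᵇ : ∀ {n} → BRel n → Bool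
ncnnᵇ r = isEquivᵇ r ∧ not (hasCrossing r) ∧ not (hasNesting r)

record IsNCNN {n} (r : BRel n) : Set where
  field
    equivalence : IsEquivalence (Holds (rel r))
    noCrossing  : hasCrossing r ≡ false
    noNesting   : hasNesting r ≡ false

ncnnᵇ⁻ : ∀ {n} (r : BRel n) → ncnnᵇ r ≡ true → IsNCNN r
ncnnᵇ⁻ r t = record
  { equivalence = isEquivᵇ⁻ r (∧-trueˡ t)
  ; noCrossing  = not-true⁻ (∧-trueˡ t′)
  ; noNesting   = not-true⁻ (∧-trueʳ {not (hasCrossing r)} t′)
  }
  where t′ = ∧-trueʳ {isEquivᵇ r} t

MinimalInBlock : ∀ {n} → BRel n → Fin n → Set
MinimalInBlock r p = ∀ x → x < p → rel r x p ≡ false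

OutsideArcPairs : ∀ {n} → BRel n → Fin n → Set
OutsideArcPairs r p =
  (∀ a b c d → crossingᵇ r a b c d ≡ true → a ≢ p × b ≢ p × c ≢ p × d ≢ p) ×
  (∀ a b c d → nestingᵇ r a b c d ≡ true → a ≢ p × b ≢ p × c ≢ p × d ≢ p)

module _ {n} (r : BRel (ℕ.suc n)) (s : BRel n) (p : Fin (ℕ.suc n))
         (restricts : ∀ i j → rel r (punchIn p i) (punchIn p j) ≡ rel s i j) where

  -- Testing consecutiveness at the extra point p would need x < p and x ~ p, which
  -- minimality of p in its block excludes.
  arc-punchIn : MinimalInBlock r p → ∀ i j → arc r (punchIn p i) (punchIn p j) ≡ arc s i j
  arc-punchIn minimal i j =
    cong₂ _∧_ (punchIn-<ᵇ p i j) (cong₂ (λ a b → a ∧ not b) (restricts i j)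
      (trans (anyF-punchIn p (λ k → (x <ᵇ k) ∧ (k <ᵇ punchIn p j) ∧ rel r x k) p-not-inside)
        (anyF-cong λ k → cong₂ _∧_ (punchIn-<ᵇ p i k) (cong₂ _∧_ (punchIn-<ᵇ p k j) (restricts i k)))))
    where
    x = punchIn p i
    p-not-inside : ((x <ᵇ p) ∧ (p <ᵇ punchIn p j) ∧ rel r x p) ≡ false
    p-not-inside = ¬-not λ t → let x<p , t′ = <ᵇ-∧⁻ t in
      ≡true⇒≢false (∧-trueʳ {p <ᵇ punchIn p j} t′) (minimal x x<p)

  ncnnᵇ-punchIn : MinimalInBlock r p → OutsideArcPairs r p →
                  IsEquivalence (Holds (rel r)) → IsEquivalence (Holds (rel s)) →
                  ncnnᵇ r ≡ ncnnᵇ s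
  ncnnᵇ-punchIn minimal (outsideCrossings , outsideNestings) Er Es =
    cong₂ _∧_ (trans (isEquivᵇ⁺ r Er) (sym (isEquivᵇ⁺ s Es)))
      (cong₂ (λ a b → not a ∧ not b)
        (any4-punchIn p (crossingᵇ r) (crossingᵇ s) crossings outsideCrossings)
        (any4-punchIn p (nestingᵇ r) (nestingᵇ s) nestings outsideNestings))
    where
    arcs = arc-punchIn minimal
    crossings : ∀ a b c d → crossingᵇ r (punchIn p a) (punchIn p b) (punchIn p c) (punchIn p d)
                          ≡ crossingᵇ s a b c d
    crossings a b c d = cong₂ _∧_ (arcs a b) (cong₂ _∧_ (arcs c d)
      (cong₂ _∧_ (punchIn-<ᵇ p a c) (cong₂ _∧_ (punchIn-<ᵇ p c b) (punchIn-<ᵇ p b d))))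
    nestings : ∀ a b c d → nestingᵇ r (punchIn p a) (punchIn p b) (punchIn p c) (punchIn p d)
                         ≡ nestingᵇ s a b c d
    nestings a b c d = cong₂ _∧_ (arcs a b) (cong₂ _∧_ (arcs c d)
      (cong₂ _∧_ (punchIn-<ᵇ p a c) (cong₂ _∧_ (punchIn-<ᵇ p c d) (punchIn-<ᵇ p d b))))

Isolated : ∀ {n} → BoolRel n → Fin n → Set
Isolated f p = ∀ x → f p x ≡ true → x ≡ p

isolated-row : ∀ {n} (f : BoolRel n) {p y} → Isolated f p → y ≢ p → f p y ≡ false
isolated-row f isolated y≢p = ¬-not (y≢p ∘ isolated _)

isolated-column : ∀ {n} (f : BoolRel n) {p x} → IsEquivalence (Holds f) → Isolated f p → x ≢ p →
                  f x p ≡ false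
isolated-column f E isolated x≢p = ¬-not (x≢p ∘ isolated _ ∘ IsEquivalence.sym E)

module _ {n} (r : BRel n) (E : IsEquivalence (Holds (rel r))) {p} (isolated : Isolated (rel r) p) where
  private module E = IsEquivalence E

  isolated-minimal : MinimalInBlock r p
  isolated-minimal x x<p = isolated-column (rel r) E isolated (<⇒≢ x<p)

  isolated-outside : OutsideArcPairs r p
  isolated-outside =
    (λ a b c d t → let ab , cd , _ = crossingᵇ⁻ r t in avoid ab cd) ,
    (λ a b c d t → let ab , cd , _ = nestingᵇ⁻ r t in avoid ab cd)
    where
    no-arc-from : ∀ {x} → IsArc (rel r) p x → ⊥
    no-arc-from a with refl ← isolated _ (related a) = <-irrefl refl (ordered a)
    no-arc-to : ∀ {x} → IsArc (rel r) x p → ⊥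
    no-arc-to a with refl ← isolated _ (E.sym (related a)) = <-irrefl refl (ordered a)
    avoid : ∀ {a b c d} → IsArc (rel r) a b → IsArc (rel r) c d → a ≢ p × b ≢ p × c ≢ p × d ≢ p
    avoid ab cd = (λ { refl → no-arc-from ab }) , (λ { refl → no-arc-to ab }) ,
                  (λ { refl → no-arc-from cd }) , (λ { refl → no-arc-to cd })

ncnnᵇ-isolated : ∀ {n} (r : BRel (ℕ.suc n)) (s : BRel n) p →
                 (∀ i j → rel r (punchIn p i) (punchIn p j) ≡ rel s i j) →
                 IsEquivalence (Holds (rel r)) → IsEquivalence (Holds (rel s)) →
                 Isolated (rel r) p → ncnnᵇ r ≡ ncnnᵇ s
ncnnᵇ-isolated r s p restricts Er Es isolated =
  ncnnᵇ-punchIn r s p restricts (isolated-minimal r Er isolated) (isolated-outside r Er isolated) Er Es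

module _ {n} (r : BRel (ℕ.suc (ℕ.suc n))) where

  arc-from-zero : rel r zero (suc zero) ≡ true → ∀ {x} → IsArc (rel r) zero x → x ≡ suc zero
  arc-from-zero r01 {zero}        a = ⊥-elim (<-irrefl refl (ordered a))
  arc-from-zero r01 {suc zero}    a = refl
  arc-from-zero r01 {suc (suc x)} a =
    ⊥-elim (≡true⇒≢false r01 (consecutive a (suc zero) ℕ.z<s (ℕ.s<s ℕ.z<s)))

  -- When 0 ~ 1, the only arc at 0 is (0 , 1) and no point lies inside it.
  linked-outside : rel r zero (suc zero) ≡ true → OutsideArcPairs r zero
  linked-outside r01 =
    (λ a b c d t → let ab , cd , a<c , c<b , _ = crossingᵇ⁻ r t in avoid ab cd a<c c<b) ,
    (λ a b c d t → let ab , cd , a<c , c<d , d<b = nestingᵇ⁻ r t in avoid ab cd a<c (<-trans c<d d<b))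
    where
    avoid : ∀ {a b c d} → IsArc (rel r) a b → IsArc (rel r) c d → a < c → c < b →
            a ≢ zero × b ≢ zero × c ≢ zero × d ≢ zero
    avoid {c = c} ab cd a<c c<b =
      (λ { refl → nothing-inside a<c (subst (c <_) (arc-from-zero r01 ab) c<b) }) ,
      (λ { refl → n≮0 (ordered ab) }) ,
      (λ { refl → n≮0 a<c }) ,
      (λ { refl → n≮0 (ordered cd) })
      where
      nothing-inside : ∀ {x : Fin (ℕ.suc (ℕ.suc n))} → zero {ℕ.suc n} < x → x < suc (zero {n}) → ⊥
      nothing-inside {suc _} _ (ℕ.s<s ())

  module _ (N : IsNCNN r) (r01 : rel r zero (suc zero) ≡ false) where
    open IsNCNN N
    private module E = IsEquivalence equivalence

    arc-over-one : ∀ {s} → IsArc (rel r) zero s → suc (zero {ℕ.suc n}) < s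
    arc-over-one {zero}        a = ⊥-elim (<-irrefl refl (ordered a))
    arc-over-one {suc zero}    a = ⊥-elim (≡true⇒≢false (related a) r01)
    arc-over-one {suc (suc s)} a = ℕ.s<s ℕ.z<s

    -- If 1 had a later partner, its arc would nest inside or cross the arc leaving 0.
    one-isolated : (∃ λ j → rel r zero (suc j) ≡ true) → Isolated (rel r) (suc zero)
    one-isolated _ zero r10 = ⊥-elim (≡true⇒≢false (E.sym r10) r01)
    one-isolated _ (suc zero) _ = refl
    one-isolated (j , r0j) (suc (suc y)) r1y
      with s , arc₀ ← arc-from r ℕ.z<s r0j | t , arc₁ ← arc-from r (ℕ.s<s ℕ.z<s) r1y
      with <-cmp t s
    ... | tri< t<s _ _ = ⊥-elim (≡true⇒≢false (any4⁺ (nestingᵇ r) zero s (suc zero) t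
            (nestingᵇ⁺ r (arc₀ , arc₁ , ℕ.z<s , ordered arc₁ , t<s))) noNesting)
    ... | tri≈ _ refl _ = ⊥-elim (≡true⇒≢false (E.trans (related arc₀) (E.sym (related arc₁))) r01)
    ... | tri> _ _ s<t = ⊥-elim (≡true⇒≢false (any4⁺ (crossingᵇ r) zero s (suc zero) t
            (crossingᵇ⁺ r (arc₀ , arc₁ , ℕ.z<s , arc-over-one arc₀ , s<t))) noCrossing)

ncnnᵇ-linked : ∀ {n} (r : BRel (ℕ.suc (ℕ.suc n))) (s : BRel (ℕ.suc n)) →
               (∀ i j → rel r (suc i) (suc j) ≡ rel s i j) →
               IsEquivalence (Holds (rel r)) → IsEquivalence (Holds (rel s)) →
               rel r zero (suc zero) ≡ true → ncnnᵇ r ≡ ncnnᵇ s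
ncnnᵇ-linked r s restricts Er Es r01 =
  ncnnᵇ-punchIn r s zero restricts (λ _ ()) (linked-outside r r01) Er Es

toMatrix : ∀ {n} → BoolRel n → BRel n
toMatrix f = tabulate λ i → tabulate (f i)

rel-toMatrix : ∀ {n} (f : BoolRel n) i j → rel (toMatrix f) i j ≡ f i j
rel-toMatrix f i j rewrite lookup∘tabulate (λ i → tabulate (f i)) i = lookup∘tabulate (f i) j

lookup-ext : ∀ {A : Set} {n} {u v : Vec A n} → (∀ i → lookup u i ≡ lookup v i) → u ≡ v
lookup-ext {u = u} {v} eq =
  trans (sym (tabulate∘lookup u)) (trans (tabulate-cong eq) (tabulate∘lookup v))

rel-ext : ∀ {n} {r s : BRel n} → (∀ i j → rel r i j ≡ rel s i j) → r ≡ s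
rel-ext eq = lookup-ext λ i → lookup-ext (eq i)

isEquivalence-cong : ∀ {n} {f g : BoolRel n} → (∀ i j → f i j ≡ g i j) →
                     IsEquivalence (Holds f) → IsEquivalence (Holds g)
isEquivalence-cong f≡g E = record
  { refl  = trans (sym (f≡g _ _)) E.refl
  ; sym   = λ gij → trans (sym (f≡g _ _)) (E.sym (trans (f≡g _ _) gij))
  ; trans = λ gij gjk → trans (sym (f≡g _ _)) (E.trans (trans (f≡g _ _) gij) (trans (f≡g _ _) gjk))
  }
  where module E = IsEquivalence E

toMatrix-isEquivalence : ∀ {n} {f : BoolRel n} →
                         IsEquivalence (Holds f) → IsEquivalence (Holds (rel (toMatrix f)))
toMatrix-isEquivalence {f = f} = isEquivalence-cong λ i j → sym (rel-toMatrix f i j)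

isolated-unique : ∀ {n} {r r′ : BRel (ℕ.suc n)} p →
                  IsEquivalence (Holds (rel r)) → IsEquivalence (Holds (rel r′)) →
                  Isolated (rel r) p → Isolated (rel r′) p →
                  (∀ i j → rel r (punchIn p i) (punchIn p j) ≡ rel r′ (punchIn p i) (punchIn p j)) →
                  r ≡ r′
isolated-unique {r = r} {r′} p Er Er′ iso iso′ restricts = rel-ext same
  where
  same : ∀ x y → rel r x y ≡ rel r′ x y
  same x y with x ≟ p | y ≟ p
  ... | yes refl | yes refl = trans (IsEquivalence.refl Er) (sym (IsEquivalence.refl Er′))
  ... | yes refl | no y≢p  = trans (isolated-row (rel r) iso y≢p) (sym (isolated-row (rel r′) iso′ y≢p))
  ... | no x≢p  | yes refl =
    trans (isolated-column (rel r) Er iso x≢p) (sym (isolated-column (rel r′) Er′ iso′ x≢p))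
  ... | no x≢p  | no y≢p
    with i , refl ← punchIn-preimage x≢p | j , refl ← punchIn-preimage y≢p = restricts i j

module _ {n} (r : BRel (ℕ.suc (ℕ.suc n))) (E : IsEquivalence (Holds (rel r)))
         (r01 : rel r zero (suc zero) ≡ true) where
  private module E = IsEquivalence E

  linked-via-one : ∀ x y → rel r x y ≡ rel r (suc (pinch zero x)) (suc (pinch zero y))
  linked-via-one x y = ⇔→≡ (mk⇔ (λ rxy → E.trans (E.sym (x~ x)) (E.trans rxy (x~ y)))
                                (λ rxy → E.trans (x~ x) (E.trans rxy (E.sym (x~ y)))))
    where
    x~ : ∀ x → rel r x (suc (pinch zero x)) ≡ true
    x~ zero    = r01
    x~ (suc x) = E.refl

linked-unique : ∀ {n} (r r′ : BRel (ℕ.suc (ℕ.suc n))) →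
                IsEquivalence (Holds (rel r)) → IsEquivalence (Holds (rel r′)) →
                rel r zero (suc zero) ≡ true → rel r′ zero (suc zero) ≡ true →
                (∀ i j → rel r (suc i) (suc j) ≡ rel r′ (suc i) (suc j)) → r ≡ r′
linked-unique r r′ Er Er′ r01 r′01 restricts = rel-ext λ x y →
  trans (linked-via-one r Er r01 x y) (trans (restricts _ _) (sym (linked-via-one r′ Er′ r′01 x y)))

singleton₀ : ∀ {n} → BoolRel n → BoolRel (ℕ.suc n)
singleton₀ g zero    zero    = true
singleton₀ g zero    (suc _) = false
singleton₀ g (suc _) zero    = false
singleton₀ g (suc i) (suc j) = g i j

singleton₀-isEquivalence : ∀ {n} {g : BoolRel n} →
                           IsEquivalence (Holds g) → IsEquivalence (Holds (singleton₀ g))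
singleton₀-isEquivalence {g = g} E = record
  { refl  = λ {i} → reflexive i
  ; sym   = λ {i} {j} → symmetric i j
  ; trans = λ {i} {j} {k} → transitive i j k
  }
  where
  module E = IsEquivalence E
  reflexive : ∀ i → singleton₀ g i i ≡ true
  reflexive zero    = refl
  reflexive (suc i) = E.refl
  symmetric : ∀ i j → singleton₀ g i j ≡ true → singleton₀ g j i ≡ true
  symmetric zero    zero    _ = refl
  symmetric (suc i) (suc j) t = E.sym t
  transitive : ∀ i j k → singleton₀ g i j ≡ true → singleton₀ g j k ≡ true → singleton₀ g i k ≡ true
  transitive zero    zero    k       _ t = t
  transitive (suc i) (suc j) zero    _ t = t
  transitive (suc i) (suc j) (suc k) s t = E.trans s t

singleton₀-isolated : ∀ {n} (g : BoolRel n) → Isolated (singleton₀ g) zero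
singleton₀-isolated g zero _ = refl

swap₀₁ : ∀ {n} → Fin (ℕ.suc (ℕ.suc n)) → Fin (ℕ.suc (ℕ.suc n))
swap₀₁ zero          = suc zero
swap₀₁ (suc zero)    = zero
swap₀₁ (suc (suc i)) = suc (suc i)

singleton₁ : ∀ {n} → BoolRel (ℕ.suc n) → BoolRel (ℕ.suc (ℕ.suc n))
singleton₁ g = singleton₀ g on swap₀₁

singleton₁-restricts : ∀ {n} (g : BoolRel (ℕ.suc n)) i j →
                       singleton₁ g (punchIn (suc zero) i) (punchIn (suc zero) j) ≡ g i j
singleton₁-restricts g zero    zero    = refl
singleton₁-restricts g zero    (suc j) = refl
singleton₁-restricts g (suc i) zero    = refl
singleton₁-restricts g (suc i) (suc j) = refl

singleton₁-isolated : ∀ {n} (g : BoolRel (ℕ.suc n)) → Isolated (singleton₁ g) (suc zero)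
singleton₁-isolated g (suc zero) _ = refl

merge₀ : ∀ {n} → BoolRel (ℕ.suc n) → BoolRel (ℕ.suc (ℕ.suc n))
merge₀ g = g on pinch zero

isolated₀ᵇ : ∀ {n} → BRel (ℕ.suc n) → Bool
isolated₀ᵇ r = allF λ j → not (rel r zero (suc j))

isolated₀ᵇ⁻ : ∀ {n} (r : BRel (ℕ.suc n)) → isolated₀ᵇ r ≡ true → Isolated (rel r) zero
isolated₀ᵇ⁻ r t zero    _   = refl
isolated₀ᵇ⁻ r t (suc j) r0j = ⊥-elim (≡true⇒≢false r0j (not-true⁻ (allF⁻ _ t j)))

isolated₀ᵇ⁺ : ∀ {n} (r : BRel (ℕ.suc n)) → Isolated (rel r) zero → isolated₀ᵇ r ≡ true
isolated₀ᵇ⁺ r isolated =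
  allF⁺ (λ j → not (rel r zero (suc j))) λ j → not-true (isolated-row (rel r) isolated (0≢1+n ∘ sym))

linked₀ : ∀ {n} (r : BRel (ℕ.suc n)) → not (isolated₀ᵇ r) ≡ true → ∃ λ j → rel r zero (suc j) ≡ true
linked₀ r t with j , f ← allF-false⁻ _ (not-true⁻ t) = j , not-false⁻ f

NCNNPartition⁺ : ℕ → Set
NCNNPartition⁺ n = Σ (NCNNPartition (ℕ.suc n)) (T ∘ not ∘ isolated₀ᵇ ∘ proj₁)

ncnnOf : ∀ {n} (π : NCNNPartition n) → IsNCNN (proj₁ π)
ncnnOf (r , ok) = ncnnᵇ⁻ r (T⇒≡true ok)

equivOf : ∀ {n} (π : NCNNPartition n) → IsEquivalence (Holds (rel (proj₁ π)))
equivOf π = IsNCNN.equivalence (ncnnOf π)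

restrict : ∀ {n} → BRel (ℕ.suc n) → Fin (ℕ.suc n) → BRel n
restrict r p = toMatrix (rel r on punchIn p)

restrict-isEquivalence : ∀ {n} (r : BRel (ℕ.suc n)) p →
                         IsEquivalence (Holds (rel r)) → IsEquivalence (Holds (rel (restrict r p)))
restrict-isEquivalence r p = toMatrix-isEquivalence ∘ On.isEquivalence (punchIn p)

rel-restrict : ∀ {n} (r : BRel (ℕ.suc n)) p i j →
               rel r (punchIn p i) (punchIn p j) ≡ rel (restrict r p) i j
rel-restrict r p i j = sym (rel-toMatrix _ i j)

isolated₀↔ : ∀ {n} → Σ (NCNNPartition (ℕ.suc n)) (T ∘ isolated₀ᵇ ∘ proj₁) ↔ NCNNPartition n
isolated₀↔ {n} = mk↔ₛ′ Delete.result Insert.result to∘from from∘to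
  where
  module Delete (x : Σ (NCNNPartition (ℕ.suc n)) (T ∘ isolated₀ᵇ ∘ proj₁)) where
    r = proj₁ (proj₁ x)
    Er = equivOf (proj₁ x)
    isolated = isolated₀ᵇ⁻ r (T⇒≡true (proj₂ x))
    s = restrict r zero
    s-restricts = rel-restrict r zero
    result : NCNNPartition n
    result = s , subst T (ncnnᵇ-isolated r s zero s-restricts Er
                           (restrict-isEquivalence r zero Er) isolated) (proj₂ (proj₁ x))

  module Insert (π : NCNNPartition n) where
    s = proj₁ π
    f = singleton₀ (rel s)
    r = toMatrix f
    Er = toMatrix-isEquivalence (singleton₀-isEquivalence (equivOf π))
    restricts : ∀ i j → rel r (suc i) (suc j) ≡ rel s i j
    restricts i j = rel-toMatrix f (suc i) (suc j)
    isolated : Isolated (rel r) zero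
    isolated x r0x = singleton₀-isolated (rel s) x (trans (sym (rel-toMatrix f zero x)) r0x)
    result : Σ (NCNNPartition (ℕ.suc n)) (T ∘ isolated₀ᵇ ∘ proj₁)
    result = (r , subst T (sym (ncnnᵇ-isolated r s zero restricts Er (equivOf π) isolated)) (proj₂ π)) ,
             ≡true⇒T (isolated₀ᵇ⁺ r isolated)

  to∘from : ∀ π → Delete.result (Insert.result π) ≡ π
  to∘from π = subtype-≡ (rel-ext λ i j →
    trans (sym (rel-restrict (Insert.r π) zero i j)) (Insert.restricts π i j))

  from∘to : ∀ x → Insert.result (Delete.result x) ≡ x
  from∘to x = subtype-≡ (subtype-≡ (isolated-unique zero I.Er D.Er I.isolated D.isolated λ i j →
                trans (I.restricts i j) (sym (D.s-restricts i j))))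
    where
    module D = Delete x
    module I = Insert (Delete.result x)

not-isolated₀ : ∀ {n} (r : BRel (ℕ.suc n)) j → rel r zero (suc j) ≡ true → not (isolated₀ᵇ r) ≡ true
not-isolated₀ r j r0j = not-true (¬-not λ t → ≡true⇒≢false r0j (not-true⁻ (allF⁻ _ t j)))

linked₀₁ᵇ : ∀ {n} → NCNNPartition⁺ (ℕ.suc n) → Bool
linked₀₁ᵇ x = rel (proj₁ (proj₁ x)) zero (suc zero)

linked₀₁↔ : ∀ {n} → Σ (NCNNPartition⁺ (ℕ.suc n)) (T ∘ linked₀₁ᵇ) ↔ NCNNPartition (ℕ.suc n)
linked₀₁↔ {n} = mk↔ₛ′ Delete.result Insert.result to∘from from∘to
  where
  module Delete (x : Σ (NCNNPartition⁺ (ℕ.suc n)) (T ∘ linked₀₁ᵇ)) where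
    r = proj₁ (proj₁ (proj₁ x))
    Er = equivOf (proj₁ (proj₁ x))
    r01 = T⇒≡true (proj₂ x)
    s = restrict r zero
    s-restricts = rel-restrict r zero
    result : NCNNPartition (ℕ.suc n)
    result = s , subst T (ncnnᵇ-linked r s s-restricts Er (restrict-isEquivalence r zero Er) r01)
                         (proj₂ (proj₁ (proj₁ x)))

  module Insert (π : NCNNPartition (ℕ.suc n)) where
    s = proj₁ π
    Es = equivOf π
    f = merge₀ (rel s)
    r = toMatrix f
    Er = toMatrix-isEquivalence (On.isEquivalence (pinch zero) Es)
    restricts : ∀ i j → rel r (suc i) (suc j) ≡ rel s i j
    restricts i j = rel-toMatrix f (suc i) (suc j)
    r01 : rel r zero (suc zero) ≡ true
    r01 = trans (rel-toMatrix f zero (suc zero)) (IsEquivalence.refl Es)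
    result : Σ (NCNNPartition⁺ (ℕ.suc n)) (T ∘ linked₀₁ᵇ)
    result = ((r , subst T (sym (ncnnᵇ-linked r s restricts Er Es r01)) (proj₂ π)) ,
              ≡true⇒T (not-isolated₀ r zero r01)) , ≡true⇒T r01

  to∘from : ∀ π → Delete.result (Insert.result π) ≡ π
  to∘from π = subtype-≡ (rel-ext λ i j →
    trans (sym (rel-restrict (Insert.r π) zero i j)) (Insert.restricts π i j))

  from∘to : ∀ x → Insert.result (Delete.result x) ≡ x
  from∘to x = subtype-≡ (subtype-≡ (subtype-≡ (linked-unique I.r D.r I.Er D.Er I.r01 D.r01 λ i j →
                trans (I.restricts i j) (sym (D.s-restricts i j)))))
    where
    module D = Delete x
    module I = Insert (Delete.result x)

isolated₁↔ : ∀ {n} → Σ (NCNNPartition⁺ (ℕ.suc n)) (T ∘ not ∘ linked₀₁ᵇ) ↔ NCNNPartition⁺ n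
isolated₁↔ {n} = mk↔ₛ′ Delete.result Insert.result to∘from from∘to
  where
  module Delete (x : Σ (NCNNPartition⁺ (ℕ.suc n)) (T ∘ not ∘ linked₀₁ᵇ)) where
    r = proj₁ (proj₁ (proj₁ x))
    N = ncnnOf (proj₁ (proj₁ x))
    Er = IsNCNN.equivalence N
    r01 = not-true⁻ (T⇒≡true (proj₂ x))
    linked = linked₀ r (T⇒≡true (proj₂ (proj₁ x)))
    isolated = one-isolated r N r01 linked
    s = restrict r (suc zero)
    s-restricts = rel-restrict r (suc zero)
    s-linked : ∃ λ j → rel s zero (suc j) ≡ true
    s-linked with linked
    ... | zero  , r01′ = ⊥-elim (≡true⇒≢false r01′ r01)
    ... | suc j , r0j  = j , trans (sym (s-restricts zero (suc j))) r0j
    result : NCNNPartition⁺ n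
    Es = restrict-isEquivalence r (suc zero) Er
    result = (s , subst T (ncnnᵇ-isolated r s (suc zero) s-restricts Er Es isolated) (proj₂ (proj₁ (proj₁ x)))) ,
             ≡true⇒T (not-isolated₀ s (proj₁ s-linked) (proj₂ s-linked))

  module Insert (π : NCNNPartition⁺ n) where
    s = proj₁ (proj₁ π)
    Es = equivOf (proj₁ π)
    f = singleton₁ (rel s)
    r = toMatrix f
    Er = toMatrix-isEquivalence (On.isEquivalence swap₀₁ (singleton₀-isEquivalence Es))
    restricts : ∀ i j → rel r (punchIn (suc zero) i) (punchIn (suc zero) j) ≡ rel s i j
    restricts i j =
      trans (rel-toMatrix f (punchIn (suc zero) i) (punchIn (suc zero) j)) (singleton₁-restricts (rel s) i j)
    isolated : Isolated (rel r) (suc zero)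
    isolated x r1x = singleton₁-isolated (rel s) x (trans (sym (rel-toMatrix f (suc zero) x)) r1x)
    s-linked = linked₀ s (T⇒≡true (proj₂ π))
    r-linked : rel r zero (suc (suc (proj₁ s-linked))) ≡ true
    r-linked = trans (restricts zero (suc (proj₁ s-linked))) (proj₂ s-linked)
    result : Σ (NCNNPartition⁺ (ℕ.suc n)) (T ∘ not ∘ linked₀₁ᵇ)
    result = ((r , subst T (sym (ncnnᵇ-isolated r s (suc zero) restricts Er Es isolated)) (proj₂ (proj₁ π))) ,
              ≡true⇒T (not-isolated₀ r (suc (proj₁ s-linked)) r-linked)) ,
             ≡true⇒T (not-true (rel-toMatrix f zero (suc zero)))

  to∘from : ∀ π → Delete.result (Insert.result π) ≡ π
  to∘from π = subtype-≡ (subtype-≡ (rel-ext λ i j →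
    trans (sym (rel-restrict (Insert.r π) (suc zero) i j)) (Insert.restricts π i j)))

  from∘to : ∀ x → Insert.result (Delete.result x) ≡ x
  from∘to x = subtype-≡ (subtype-≡ (subtype-≡
    (isolated-unique (suc zero) I.Er D.Er I.isolated D.isolated λ i j →
      trans (I.restricts i j) (sym (D.s-restricts i j)))))
    where
    module D = Delete x
    module I = Insert (Delete.result x)

-- Permutations avoiding 321 and 3412

module _ {n} (w : Vec (Fin n) n) where
  private W = lookup w

  occurrence321ᵇ : Triple n
  occurrence321ᵇ i j k = (i <ᵇ j) ∧ (j <ᵇ k) ∧ (W j <ᵇ W i) ∧ (W k <ᵇ W j)

  occurrence3412ᵇ : Quad n
  occurrence3412ᵇ i j k l = (i <ᵇ j) ∧ (j <ᵇ k) ∧ (k <ᵇ l) ∧ (W k <ᵇ W l) ∧ (W l <ᵇ W i) ∧ (W i <ᵇ W j)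

  Occurrence321 : Fin n → Fin n → Fin n → Set
  Occurrence321 i j k = i < j × j < k × W j < W i × W k < W j

  Occurrence3412 : Fin n → Fin n → Fin n → Fin n → Set
  Occurrence3412 i j k l = i < j × j < k × k < l × W k < W l × W l < W i × W i < W j

  occurrence321ᵇ⁻ : ∀ i j k → occurrence321ᵇ i j k ≡ true → Occurrence321 i j k
  occurrence321ᵇ⁻ _ _ _ t with i<j , t ← <ᵇ-∧⁻ t with j<k , t ← <ᵇ-∧⁻ t with wj<wi , wk<wj ← <ᵇ-∧⁻ t =
    i<j , j<k , wj<wi , <ᵇ⇒< wk<wj

  occurrence321ᵇ⁺ : ∀ i j k → Occurrence321 i j k → occurrence321ᵇ i j k ≡ true
  occurrence321ᵇ⁺ _ _ _ (i<j , j<k , wj<wi , wk<wj) = <ᵇ-∧⁺ i<j (<ᵇ-∧⁺ j<k (<ᵇ-∧⁺ wj<wi (<⇒<ᵇ wk<wj)))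

  occurrence3412ᵇ⁻ : ∀ i j k l → occurrence3412ᵇ i j k l ≡ true → Occurrence3412 i j k l
  occurrence3412ᵇ⁻ _ _ _ _ t with i<j , t ← <ᵇ-∧⁻ t with j<k , t ← <ᵇ-∧⁻ t with k<l , t ← <ᵇ-∧⁻ t
                     with wk<wl , t ← <ᵇ-∧⁻ t with wl<wi , wi<wj ← <ᵇ-∧⁻ t =
    i<j , j<k , k<l , wk<wl , wl<wi , <ᵇ⇒< wi<wj

  occurrence3412ᵇ⁺ : ∀ i j k l → Occurrence3412 i j k l → occurrence3412ᵇ i j k l ≡ true
  occurrence3412ᵇ⁺ _ _ _ _ (i<j , j<k , k<l , wk<wl , wl<wi , wi<wj) =
    <ᵇ-∧⁺ i<j (<ᵇ-∧⁺ j<k (<ᵇ-∧⁺ k<l (<ᵇ-∧⁺ wk<wl (<ᵇ-∧⁺ wl<wi (<⇒<ᵇ wi<wj)))))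

  isPermᵇ⁻ : isPermᵇ w ≡ true → Injective _≡_ _≡_ W
  isPermᵇ⁻ t {i} {j} wi≡wj = ≡ᵇ⇒≡ (⇒ᵇ-true⁻ (allF⁻ _ (allF⁻ _ t i) j) (≡⇒≡ᵇ wi≡wj))

  isPermᵇ⁺ : Injective _≡_ _≡_ W → isPermᵇ w ≡ true
  isPermᵇ⁺ inj = allF⁺ (λ i → allF λ j → (W i ≡ᵇ W j) ⇒ᵇ (i ≡ᵇ j)) λ i →
                 allF⁺ (λ j → (W i ≡ᵇ W j) ⇒ᵇ (i ≡ᵇ j)) λ j → ⇒ᵇ-true (≡⇒≡ᵇ ∘ inj ∘ ≡ᵇ⇒≡)

  avoidsᵇ : Bool
  avoidsᵇ = isPermᵇ w ∧ not (contains321 w) ∧ not (contains3412 w)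

  record Avoids : Set where
    field
      injective : Injective _≡_ _≡_ W
      no321     : contains321 w ≡ false
      no3412    : contains3412 w ≡ false

  avoidsᵇ⁻ : avoidsᵇ ≡ true → Avoids
  avoidsᵇ⁻ t = record
    { injective = isPermᵇ⁻ (∧-trueˡ t)
    ; no321     = not-true⁻ (∧-trueˡ t′)
    ; no3412    = not-true⁻ (∧-trueʳ {not (contains321 w)} t′)
    }
    where t′ = ∧-trueʳ {isPermᵇ w} t

  avoidsᵇ⁺ : Avoids → avoidsᵇ ≡ true
  avoidsᵇ⁺ A =
    ∧-true (isPermᵇ⁺ (Avoids.injective A)) (∧-true (not-true (Avoids.no321 A)) (not-true (Avoids.no3412 A)))

  OutsideOccurrences : Fin n → Set
  OutsideOccurrences p =
    (∀ a b c → occurrence321ᵇ a b c ≡ true → a ≢ p × b ≢ p × c ≢ p) ×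
    (∀ a b c d → occurrence3412ᵇ a b c d ≡ true → a ≢ p × b ≢ p × c ≢ p × d ≢ p)

record Extends {n} (w : Fin (ℕ.suc n) → Fin (ℕ.suc n)) (p v : Fin (ℕ.suc n)) (u : Fin n → Fin n) :
               Set where
  constructor extends
  field
    at-p  : w p ≡ v
    off-p : ∀ i → w (punchIn p i) ≡ punchIn v (u i)

module _ {n} {w : Fin (ℕ.suc n) → Fin (ℕ.suc n)} {p v : Fin (ℕ.suc n)} {u : Fin n → Fin n} where

  extends-injective⁺ : Extends w p v u → Injective _≡_ _≡_ u → Injective _≡_ _≡_ w
  extends-injective⁺ (extends wp wpᶜ) inj {x} {y} wx≡wy with x ≟ p | y ≟ p
  ... | yes refl | yes refl = refl
  ... | yes refl | no y≢p with j , refl ← punchIn-preimage y≢p =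
    ⊥-elim (punchInᵢ≢i v (u j) (trans (sym (wpᶜ j)) (trans (sym wx≡wy) wp)))
  ... | no x≢p | yes refl with i , refl ← punchIn-preimage x≢p =
    ⊥-elim (punchInᵢ≢i v (u i) (trans (sym (wpᶜ i)) (trans wx≡wy wp)))
  ... | no x≢p | no y≢p with i , refl ← punchIn-preimage x≢p | j , refl ← punchIn-preimage y≢p =
    cong (punchIn p) (inj (punchIn-injective v _ _ (trans (sym (wpᶜ i)) (trans wx≡wy (wpᶜ j)))))

  extends-injective⁻ : Extends w p v u → Injective _≡_ _≡_ w → Injective _≡_ _≡_ u
  extends-injective⁻ (extends _ wpᶜ) inj {i} {j} ui≡uj =
    punchIn-injective p i j (inj (trans (wpᶜ i) (trans (cong (punchIn v) ui≡uj) (sym (wpᶜ j)))))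

extends-unique : ∀ {n} {w w′ : Fin (ℕ.suc n) → Fin (ℕ.suc n)} {p v} {u : Fin n → Fin n} →
                 Extends w p v u → Extends w′ p v u → ∀ x → w x ≡ w′ x
extends-unique {p = p} (extends wp wpᶜ) (extends w′p w′pᶜ) x with x ≟ p
... | yes refl = trans wp (sym w′p)
... | no x≢p with i , refl ← punchIn-preimage x≢p = trans (wpᶜ i) (sym (w′pᶜ i))

extends-unique′ : ∀ {n} {w : Fin (ℕ.suc n) → Fin (ℕ.suc n)} {p v} {u u′ : Fin n → Fin n} →
                  Extends w p v u → Extends w p v u′ → ∀ i → u i ≡ u′ i
extends-unique′ {p = p} {v} (extends _ wpᶜ) (extends _ w′pᶜ) i =
  punchIn-injective v _ _ (trans (sym (wpᶜ i)) (w′pᶜ i))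

insert : ∀ {n} → Fin (ℕ.suc n) → Fin (ℕ.suc n) → (Fin n → Fin n) → Fin (ℕ.suc n) → Fin (ℕ.suc n)
insert p v u x with p ≟ x
... | yes _   = v
... | no p≢x = punchIn v (u (punchOut p≢x))

insert-extends : ∀ {n} p v (u : Fin n → Fin n) → Extends (insert p v u) p v u
insert-extends p v u = extends at-p off-p
  where
  at-p : insert p v u p ≡ v
  at-p with p ≟ p
  ... | yes _   = refl
  ... | no p≢p = contradiction refl p≢p
  off-p : ∀ i → insert p v u (punchIn p i) ≡ punchIn v (u i)
  off-p i with p ≟ punchIn p i
  ... | yes p≡pᵢ = contradiction (sym p≡pᵢ) (punchInᵢ≢i p i)
  ... | no p≢pᵢ = cong (punchIn v ∘ u) (trans (punchOut-cong p refl) (punchOut-punchIn p))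

remove : ∀ {n} p v (w : Fin (ℕ.suc n) → Fin (ℕ.suc n)) → Injective _≡_ _≡_ w → w p ≡ v → Fin n → Fin n
remove p v w inj wp i = punchOut {i = v} {j = w (punchIn p i)} λ v≡wpᵢ →
  punchInᵢ≢i p i (sym (inj (trans wp v≡wpᵢ)))

remove-extends : ∀ {n} p v (w : Fin (ℕ.suc n) → Fin (ℕ.suc n)) (inj : Injective _≡_ _≡_ w) (wp : w p ≡ v) →
                 Extends w p v (remove p v w inj wp)
remove-extends p v w inj wp = extends wp λ i → sym (punchIn-punchOut _)

tabulate-extends : ∀ {n} {w : Fin (ℕ.suc n) → Fin (ℕ.suc n)} {p v u} →
                   Extends w p v u → Extends (lookup (tabulate w)) p v u
tabulate-extends {w = w} (extends wp wpᶜ) =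
  extends (trans (lookup∘tabulate w _) wp) λ i → trans (lookup∘tabulate w _) (wpᶜ i)

extends-tabulate : ∀ {n} {w : Fin (ℕ.suc n) → Fin (ℕ.suc n)} {p v u} →
                   Extends w p v u → Extends w p v (lookup (tabulate u))
extends-tabulate {u = u} (extends wp wpᶜ) =
  extends wp λ i → trans (wpᶜ i) (cong (punchIn _) (sym (lookup∘tabulate u i)))

module _ {n} (w : Vec (Fin (ℕ.suc n)) (ℕ.suc n)) (u : Vec (Fin n) n) {p v : Fin (ℕ.suc n)}
         (ext : Extends (lookup w) p v (lookup u)) (outside : OutsideOccurrences w p) where
  private
    positions : ∀ a b → (punchIn p a <ᵇ punchIn p b) ≡ (a <ᵇ b)
    positions = punchIn-<ᵇ p
    values : ∀ a b → (lookup w (punchIn p a) <ᵇ lookup w (punchIn p b)) ≡ (lookup u a <ᵇ lookup u b)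
    values a b = trans (cong₂ _<ᵇ_ (Extends.off-p ext a) (Extends.off-p ext b)) (punchIn-<ᵇ v _ _)

    contains321-≡ : contains321 w ≡ contains321 u
    contains321-≡ = any3-punchIn p (occurrence321ᵇ w) (occurrence321ᵇ u)
      (λ a b c → cong₂ _∧_ (positions a b) (cong₂ _∧_ (positions b c) (cong₂ _∧_ (values b a) (values c b))))
      (proj₁ outside)

    contains3412-≡ : contains3412 w ≡ contains3412 u
    contains3412-≡ = any4-punchIn p (occurrence3412ᵇ w) (occurrence3412ᵇ u)
      (λ a b c d → cong₂ _∧_ (positions a b) (cong₂ _∧_ (positions b c) (cong₂ _∧_ (positions c d)
        (cong₂ _∧_ (values c d) (cong₂ _∧_ (values d a) (values a b))))))
      (proj₂ outside)

  avoids-extends⁺ : Avoids u → Avoids w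
  avoids-extends⁺ A = record
    { injective = extends-injective⁺ ext (Avoids.injective A)
    ; no321     = trans contains321-≡ (Avoids.no321 A)
    ; no3412    = trans contains3412-≡ (Avoids.no3412 A)
    }

  avoids-extends⁻ : Avoids w → Avoids u
  avoids-extends⁻ A = record
    { injective = extends-injective⁻ ext (Avoids.injective A)
    ; no321     = trans (sym contains321-≡) (Avoids.no321 A)
    ; no3412    = trans (sym contains3412-≡) (Avoids.no3412 A)
    }

below-zero : ∀ {n} {x y : Fin (ℕ.suc n)} → y ≡ zero → x < y → ⊥
below-zero refl = n≮0

below-one : ∀ {n} {x y z : Fin (ℕ.suc (ℕ.suc n))} → z ≡ suc zero → x < y → y < z → ⊥
below-one refl x<y y<1 = n≮0 (<-≤-trans x<y (ℕ.s≤s⁻¹ y<1))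

module _ {n} (w : Vec (Fin (ℕ.suc n)) (ℕ.suc n)) where
  private W = lookup w

  -- A minimum preceded by at most one position can only play the role of the final 1 in a 321
  -- or the 1 in a 3412, and both need two earlier positions.
  early-zero-outside : ∀ {p} → toℕ p ℕ.≤ 1 → W p ≡ zero → OutsideOccurrences w p
  early-zero-outside {p} early wp≡0 =
    (λ a b c t → let a<b , b<c , wb<wa , wc<wb = occurrence321ᵇ⁻ w a b c t in
      (λ { refl → below-zero wp≡0 wb<wa }) , (λ { refl → below-zero wp≡0 wc<wb }) ,
      (λ { refl → two-before a<b b<c })) ,
    (λ a b c d t → let a<b , b<c , c<d , wc<wd , wd<wa , wa<wb = occurrence3412ᵇ⁻ w a b c d t in
      (λ { refl → below-zero wp≡0 wd<wa }) , (λ { refl → below-zero wp≡0 wa<wb }) ,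
      (λ { refl → two-before a<b b<c }) , (λ { refl → two-before a<b (<-trans b<c c<d) }))
    where
    two-before : ∀ {i j} → i < j → j < p → ⊥
    two-before i<j j<p = n≮0 (<-≤-trans i<j (ℕ.s≤s⁻¹ (<-≤-trans j<p early)))

module _ {n} (w : Vec (Fin (ℕ.suc (ℕ.suc n))) (ℕ.suc (ℕ.suc n))) where
  private W = lookup w

  -- The 3 of a 321 and the 3 of a 3412 both lie above two smaller values.
  zero↦one-outside : W zero ≡ suc zero → OutsideOccurrences w zero
  zero↦one-outside w0≡1 =
    (λ a b c t → let a<b , b<c , wb<wa , wc<wb = occurrence321ᵇ⁻ w a b c t in
      (λ { refl → below-one w0≡1 wc<wb wb<wa }) , (λ { refl → n≮0 a<b }) , (λ { refl → n≮0 b<c })) ,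
    (λ a b c d t → let a<b , b<c , c<d , wc<wd , wd<wa , wa<wb = occurrence3412ᵇ⁻ w a b c d t in
      (λ { refl → below-one w0≡1 wc<wd wd<wa }) , (λ { refl → n≮0 a<b }) ,
      (λ { refl → n≮0 b<c }) , (λ { refl → n≮0 c<d }))

injective⇒surjective : ∀ {n} (f : Fin n → Fin n) → Injective _≡_ _≡_ f → ∀ y → ∃ λ x → f x ≡ y
injective⇒surjective {ℕ.suc m} f inj y with any? (λ x → f x ≟ y)
... | yes found = found
... | no missing = ⊥-elim (collision (pigeonhole (n<1+n m) (λ x → punchOut (y≢f x))))
  where
  y≢f : ∀ x → y ≢ f x
  y≢f x = missing ∘ (x ,_) ∘ sym
  collision : (∃ λ i → ∃ λ j → i < j × punchOut (y≢f i) ≡ punchOut (y≢f j)) → ⊥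
  collision (i , j , i<j , eq) = <-irrefl (cong toℕ (inj (punchOut-injective (y≢f i) (y≢f j) eq))) i<j

module _ {n} {w : Vec (Fin (ℕ.suc (ℕ.suc n))) (ℕ.suc (ℕ.suc n))} (A : Avoids w) where
  private
    W = lookup w
    F = Fin (ℕ.suc (ℕ.suc n))
    one : F
    one = suc zero

    no321 : ∀ a b c → Occurrence321 w a b c → ⊥
    no321 a b c occ =
      ≡true⇒≢false (any3⁺ (occurrence321ᵇ w) a b c (occurrence321ᵇ⁺ w a b c occ)) (Avoids.no321 A)

    no3412 : ∀ a b c d → Occurrence3412 w a b c d → ⊥
    no3412 a b c d occ =
      ≡true⇒≢false (any4⁺ (occurrence3412ᵇ w) a b c d (occurrence3412ᵇ⁺ w a b c d occ)) (Avoids.no3412 A)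

    positive : ∀ {x : F} → x ≢ zero → zero {ℕ.suc n} < x
    positive {zero}  x≢0 = contradiction refl x≢0
    positive {suc _} _   = ℕ.z<s

    above-one : ∀ {x : F} → x ≢ zero → x ≢ one → one < x
    above-one {zero}        x≢0 _   = contradiction refl x≢0
    above-one {suc zero}    _   x≢1 = contradiction refl x≢1
    above-one {suc (suc _)} _   _   = ℕ.s<s ℕ.z<s

    ascent : ∀ {p} → W (suc (suc p)) ≡ zero → W one ≢ zero → W zero < W one
    ascent {p} wp≡0 w1≢0 with <-cmp (W zero) (W one)
    ... | tri< w0<w1 _ _ = w0<w1
    ... | tri≈ _ w0≡w1 _ = ⊥-elim (0≢1+n (Avoids.injective A w0≡w1))
    ... | tri> _ _ w1<w0 = ⊥-elim (no321 zero one (suc (suc p))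
            (ℕ.z<s , ℕ.s<s ℕ.z<s , w1<w0 , subst (_< W one) (sym wp≡0) (positive w1≢0)))

  -- 0 sits at a position p ≥ 2, and w(0) < w(1) since otherwise w(0) w(1) 0 is a 321.
  -- If w(0) ≠ 1, then 1 sits at a position q ≥ 2: for q < p, w(1) 1 0 is a 321, and for
  -- q > p, w(0) w(1) 0 1 is a 3412.
  first-value-one : W zero ≢ zero → W one ≢ zero → W zero ≡ one
  first-value-one w0≢0 w1≢0
    with injective⇒surjective W (Avoids.injective A) zero
  ... | zero , w0≡0 = contradiction w0≡0 w0≢0
  ... | suc zero , w1≡0 = contradiction w1≡0 w1≢0
  ... | suc (suc p) , wp≡0 with W zero ≟ one
  ...   | yes w0≡1 = w0≡1
  ...   | no w0≢1 with injective⇒surjective W (Avoids.injective A) one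
  ...     | zero , w0≡1 = contradiction w0≡1 w0≢1
  ...     | suc zero , w1≡1 = ⊥-elim (below-one w1≡1 (positive w0≢0) (ascent wp≡0 w1≢0))
  ...     | suc (suc q) , wq≡1 with <-cmp (suc (suc q)) (suc (suc p))
  ...       | tri< q<p _ _ = ⊥-elim (no321 one (suc (suc q)) (suc (suc p))
                (ℕ.s<s ℕ.z<s , q<p , subst (_< W one) (sym wq≡1) 1<w1 , wp<wq))
    where 1<w1 = <-trans (above-one w0≢0 w0≢1) (ascent wp≡0 w1≢0)
          wp<wq = subst₂ _<_ (sym wp≡0) (sym wq≡1) (ℕ.z<s {0})
  ...       | tri≈ _ q≡p _ = ⊥-elim (0≢1+n (trans (sym wp≡0) (trans (cong W (sym q≡p)) wq≡1)))
  ...       | tri> _ _ p<q = ⊥-elim (no3412 zero one (suc (suc p)) (suc (suc q))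
                (ℕ.z<s , ℕ.s<s ℕ.z<s , p<q , wp<wq , subst (_< W zero) (sym wq≡1) (above-one w0≢0 w0≢1) ,
                 ascent wp≡0 w1≢0))
    where wp<wq = subst₂ _<_ (sym wp≡0) (sym wq≡1) (ℕ.z<s {0})

fixes₀ᵇ : ∀ {n} → Av321-3412 (ℕ.suc n) → Bool
fixes₀ᵇ σ = lookup (proj₁ σ) zero ≡ᵇ zero

Av321-3412⁺ : ℕ → Set
Av321-3412⁺ n = Σ (Av321-3412 (ℕ.suc n)) (T ∘ not ∘ fixes₀ᵇ)

avoidsOf : ∀ {n} (σ : Av321-3412 n) → Avoids (proj₁ σ)
avoidsOf (w , ok) = avoidsᵇ⁻ w (T⇒≡true ok)

pack : ∀ {n} (w : Vec (Fin n) n) → Avoids w → Av321-3412 n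
pack w A = w , ≡true⇒T (avoidsᵇ⁺ w A)

≢⇒not-≡ᵇ : ∀ {n} {x y : Fin n} → x ≢ y → not (x ≡ᵇ y) ≡ true
≢⇒not-≡ᵇ x≢y = not-true (¬-not (x≢y ∘ ≡ᵇ⇒≡))

not-≡ᵇ⇒≢ : ∀ {n} {x y : Fin n} → not (x ≡ᵇ y) ≡ true → x ≢ y
not-≡ᵇ⇒≢ t x≡y = ≡true⇒≢false (≡⇒≡ᵇ x≡y) (not-true⁻ t)

module _ {n} (p v : Fin (ℕ.suc n)) where

  insertVec : Vec (Fin n) n → Vec (Fin (ℕ.suc n)) (ℕ.suc n)
  insertVec u = tabulate (insert p v (lookup u))

  insertVec-extends : ∀ u → Extends (lookup (insertVec u)) p v (lookup u)
  insertVec-extends u = tabulate-extends (insert-extends p v (lookup u))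

  removeVec : (w : Vec (Fin (ℕ.suc n)) (ℕ.suc n)) → Injective _≡_ _≡_ (lookup w) → lookup w p ≡ v →
              Vec (Fin n) n
  removeVec w inj wp = tabulate (remove p v (lookup w) inj wp)

  removeVec-extends : ∀ w (inj : Injective _≡_ _≡_ (lookup w)) wp →
                      Extends (lookup w) p v (lookup (removeVec w inj wp))
  removeVec-extends w inj wp = extends-tabulate (remove-extends p v (lookup w) inj wp)

  removeVec-insertVec : ∀ u (inj : Injective _≡_ _≡_ (lookup (insertVec u))) wp →
                        removeVec (insertVec u) inj wp ≡ u
  removeVec-insertVec u inj wp =
    lookup-ext (extends-unique′ (removeVec-extends (insertVec u) inj wp) (insertVec-extends u))

  insertVec-removeVec : ∀ w (inj : Injective _≡_ _≡_ (lookup w)) wp → insertVec (removeVec w inj wp) ≡ w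
  insertVec-removeVec w inj wp =
    lookup-ext (extends-unique (insertVec-extends (removeVec w inj wp)) (removeVec-extends w inj wp))

fixed₀↔ : ∀ {n} → Σ (Av321-3412 (ℕ.suc n)) (T ∘ fixes₀ᵇ) ↔ Av321-3412 n
fixed₀↔ {n} = mk↔ₛ′ Delete.result Insert.result to∘from from∘to
  where
  module Delete (x : Σ (Av321-3412 (ℕ.suc n)) (T ∘ fixes₀ᵇ)) where
    w = proj₁ (proj₁ x)
    A = avoidsOf (proj₁ x)
    w0≡0 = ≡ᵇ⇒≡ (T⇒≡true (proj₂ x))
    u = removeVec zero zero w (Avoids.injective A) w0≡0
    result : Av321-3412 n
    result = pack u (avoids-extends⁻ w u (removeVec-extends zero zero w (Avoids.injective A) w0≡0)
                                          (early-zero-outside w z≤n w0≡0) A)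

  module Insert (σ : Av321-3412 n) where
    u = proj₁ σ
    w = insertVec zero zero u
    ext = insertVec-extends zero zero u
    A = avoids-extends⁺ w u ext (early-zero-outside w z≤n (Extends.at-p ext)) (avoidsOf σ)
    result : Σ (Av321-3412 (ℕ.suc n)) (T ∘ fixes₀ᵇ)
    result = pack w A , ≡true⇒T (≡⇒≡ᵇ (Extends.at-p ext))

  to∘from : ∀ σ → Delete.result (Insert.result σ) ≡ σ
  to∘from σ = subtype-≡ (removeVec-insertVec zero zero (proj₁ σ) (Avoids.injective D.A) D.w0≡0)
    where module D = Delete (Insert.result σ)

  from∘to : ∀ x → Insert.result (Delete.result x) ≡ x
  from∘to x = subtype-≡ (subtype-≡ (insertVec-removeVec zero zero D.w (Avoids.injective D.A) D.w0≡0))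
    where module D = Delete x

sends₁↦₀ᵇ : ∀ {n} → Av321-3412⁺ (ℕ.suc n) → Bool
sends₁↦₀ᵇ x = lookup (proj₁ (proj₁ x)) (suc zero) ≡ᵇ zero

sends₁↦₀↔ : ∀ {n} → Σ (Av321-3412⁺ (ℕ.suc n)) (T ∘ sends₁↦₀ᵇ) ↔ Av321-3412 (ℕ.suc n)
sends₁↦₀↔ {n} = mk↔ₛ′ Delete.result Insert.result to∘from from∘to
  where
  module Delete (x : Σ (Av321-3412⁺ (ℕ.suc n)) (T ∘ sends₁↦₀ᵇ)) where
    w = proj₁ (proj₁ (proj₁ x))
    A = avoidsOf (proj₁ (proj₁ x))
    w1≡0 = ≡ᵇ⇒≡ (T⇒≡true (proj₂ x))
    u = removeVec (suc zero) zero w (Avoids.injective A) w1≡0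
    result : Av321-3412 (ℕ.suc n)
    result = pack u (avoids-extends⁻ w u (removeVec-extends (suc zero) zero w (Avoids.injective A) w1≡0)
                                          (early-zero-outside w (s≤s z≤n) w1≡0) A)

  module Insert (σ : Av321-3412 (ℕ.suc n)) where
    u = proj₁ σ
    w = insertVec (suc zero) zero u
    ext = insertVec-extends (suc zero) zero u
    A = avoids-extends⁺ w u ext (early-zero-outside w (s≤s z≤n) (Extends.at-p ext)) (avoidsOf σ)
    w0≢0 : lookup w zero ≢ zero
    w0≢0 w0≡0 with () ← trans (sym (Extends.off-p ext zero)) w0≡0
    result : Σ (Av321-3412⁺ (ℕ.suc n)) (T ∘ sends₁↦₀ᵇ)
    result = (pack w A , ≡true⇒T (≢⇒not-≡ᵇ w0≢0)) , ≡true⇒T (≡⇒≡ᵇ (Extends.at-p ext))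

  to∘from : ∀ σ → Delete.result (Insert.result σ) ≡ σ
  to∘from σ = subtype-≡ (removeVec-insertVec (suc zero) zero (proj₁ σ) (Avoids.injective D.A) D.w1≡0)
    where module D = Delete (Insert.result σ)

  from∘to : ∀ x → Insert.result (Delete.result x) ≡ x
  from∘to x = subtype-≡ (subtype-≡ (subtype-≡
    (insertVec-removeVec (suc zero) zero D.w (Avoids.injective D.A) D.w1≡0)))
    where module D = Delete x

punchIn-one-zero : ∀ {n} {x : Fin (ℕ.suc n)} → punchIn (suc zero) x ≡ zero → x ≡ zero
punchIn-one-zero {x = zero} _ = refl

first-value-one↔ : ∀ {n} → Σ (Av321-3412⁺ (ℕ.suc n)) (T ∘ not ∘ sends₁↦₀ᵇ) ↔ Av321-3412⁺ n
first-value-one↔ {n} = mk↔ₛ′ Delete.result Insert.result to∘from from∘to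
  where
  module Delete (x : Σ (Av321-3412⁺ (ℕ.suc n)) (T ∘ not ∘ sends₁↦₀ᵇ)) where
    w = proj₁ (proj₁ (proj₁ x))
    A = avoidsOf (proj₁ (proj₁ x))
    w1≢0 = not-≡ᵇ⇒≢ (T⇒≡true (proj₂ x))
    w0≡1 = first-value-one A (not-≡ᵇ⇒≢ (T⇒≡true (proj₂ (proj₁ x)))) w1≢0
    u = removeVec zero (suc zero) w (Avoids.injective A) w0≡1
    ext = removeVec-extends zero (suc zero) w (Avoids.injective A) w0≡1
    u0≢0 : lookup u zero ≢ zero
    u0≢0 u0≡0 = w1≢0 (trans (Extends.off-p ext zero) (cong (punchIn (suc zero)) u0≡0))
    result : Av321-3412⁺ n
    result = pack u (avoids-extends⁻ w u ext (zero↦one-outside w w0≡1) A) , ≡true⇒T (≢⇒not-≡ᵇ u0≢0)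

  module Insert (σ : Av321-3412⁺ n) where
    u = proj₁ (proj₁ σ)
    w = insertVec zero (suc zero) u
    ext = insertVec-extends zero (suc zero) u
    A = avoids-extends⁺ w u ext (zero↦one-outside w (Extends.at-p ext)) (avoidsOf (proj₁ σ))
    w0≢0 : lookup w zero ≢ zero
    w0≢0 w0≡0 with () ← trans (sym (Extends.at-p ext)) w0≡0
    w1≢0 : lookup w (suc zero) ≢ zero
    w1≢0 w1≡0 = not-≡ᵇ⇒≢ (T⇒≡true (proj₂ σ)) (punchIn-one-zero (trans (sym (Extends.off-p ext zero)) w1≡0))
    result : Σ (Av321-3412⁺ (ℕ.suc n)) (T ∘ not ∘ sends₁↦₀ᵇ)
    result = (pack w A , ≡true⇒T (≢⇒not-≡ᵇ w0≢0)) , ≡true⇒T (≢⇒not-≡ᵇ w1≢0)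

  to∘from : ∀ σ → Delete.result (Insert.result σ) ≡ σ
  to∘from σ = subtype-≡ (subtype-≡
    (removeVec-insertVec zero (suc zero) (proj₁ (proj₁ σ)) (Avoids.injective D.A) D.w0≡1))
    where module D = Delete (Insert.result σ)

  from∘to : ∀ x → Insert.result (Delete.result x) ≡ x
  from∘to x = subtype-≡ (subtype-≡ (subtype-≡
    (insertVec-removeVec zero (suc zero) D.w (Avoids.injective D.A) D.w0≡1)))
    where module D = Delete x

-- The common recursion

ncnn-split : ∀ {n} → NCNNPartition (ℕ.suc n) ↔ (NCNNPartition n ⊎ NCNNPartition⁺ n)
ncnn-split = ↔-trans (split↔ (isolated₀ᵇ ∘ proj₁)) (isolated₀↔ ⊎-↔ ↔-refl)

ncnn⁺-split : ∀ {n} → NCNNPartition⁺ (ℕ.suc n) ↔ (NCNNPartition (ℕ.suc n) ⊎ NCNNPartition⁺ n)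
ncnn⁺-split = ↔-trans (split↔ linked₀₁ᵇ) (linked₀₁↔ ⊎-↔ isolated₁↔)

av-split : ∀ {n} → Av321-3412 (ℕ.suc n) ↔ (Av321-3412 n ⊎ Av321-3412⁺ n)
av-split = ↔-trans (split↔ fixes₀ᵇ) (fixed₀↔ ⊎-↔ ↔-refl)

av⁺-split : ∀ {n} → Av321-3412⁺ (ℕ.suc n) ↔ (Av321-3412 (ℕ.suc n) ⊎ Av321-3412⁺ n)
av⁺-split = ↔-trans (split↔ sends₁↦₀ᵇ) (sends₁↦₀↔ ⊎-↔ first-value-one↔)

mutual
  ncnn↔av : ∀ n → NCNNPartition n ↔ Av321-3412 n
  ncnn↔av 0 = mk↔ₛ′ (λ _ → [] , tt) (λ _ → [] , tt) (λ { ([] , tt) → refl }) (λ { ([] , tt) → refl })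
  ncnn↔av (ℕ.suc n) = ↔-trans ncnn-split (↔-trans (ncnn↔av n ⊎-↔ ncnn⁺↔av⁺ n) (↔-sym av-split))

  ncnn⁺↔av⁺ : ∀ n → NCNNPartition⁺ n ↔ Av321-3412⁺ n
  ncnn⁺↔av⁺ 0 =
    mk↔ₛ′ (λ { (_ , ()) }) (λ { ((zero ∷ [] , _) , ()) }) (λ { ((zero ∷ [] , _) , ()) }) (λ { (_ , ()) })
  ncnn⁺↔av⁺ (ℕ.suc n) = ↔-trans ncnn⁺-split (↔-trans (ncnn↔av (ℕ.suc n) ⊎-↔ ncnn⁺↔av⁺ n) (↔-sym av⁺-split))

mainTheorem8 : (n : ℕ) → n ≥ 1 → NCNNPartition n ⤖ Av321-3412 n
mainTheorem8 n _ = ↔⇒⤖ (ncnn↔av n)
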